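{- There exists a constant $\varepsilon>0$ such that for strings $x,y\in\{0,1\}^n$, any deterministic $R$-pass streaming algorithm that approximates $\mathsf{ED}(x,y)$ within an additive error of $\varepsilon n$ needs $\Omega(n/R)$ space.
   Context: $\mathsf{ED}(x,y)$ is the edit distance (minimum number of single-character insertions, deletions and substitutions transforming $x$ into $y$). In the (standard) streaming model both input strings are given only through sequential (left-to-right) streaming access, read once per pass; space is the working memory of the algorithm. -}

module Defs where

open import Data.Nat using (ℕ; zero; suc; _+_; _^_; _⊓_)
open import Data.Bool using (Bool; true; false; if_then_else_)
open import Data.Bool.Properties using () renaming (_≟_ to _≟B_)
open import Data.List using (List; []; _∷_; length; _++_)
open import Data.Vec using (Vec; toList)
open import Data.Fin using (Fin)
open import Relation.Nullary using (does)

ED : List Bool → List Bool → ℕ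
ED [] ys = length ys
ED (x ∷ xs) [] = suc (length xs)
ED (x ∷ xs) (y ∷ ys) =
  (ED xs ys + (if does (x ≟B y) then 0 else 1))
  ⊓ suc (ED xs (y ∷ ys) ⊓ ED (x ∷ xs) ys)

State : ℕ → Set
State s = Vec Bool s

-- The transition may depend (non-uniformly) on the pass number and the
-- position of the symbol in the stream; the memory content is carried
-- over between passes; the answer is a function of the final memory.
record StreamAlg (s : ℕ) : Set where
  field
    init : State s
    step : (pass : ℕ) → (pos : ℕ) → State s → Bool → State s
    out  : State s → ℕ

open StreamAlg public

runPass : {s : ℕ} → (ℕ → State s → Bool → State s) → ℕ → State s → List Bool → State s
runPass {s} f i q [] = q
runPass {s} f i q (b ∷ bs) = runPass {s} f (suc i) (f i q b) bs

runPasses : {s : ℕ} → StreamAlg s → (p r : ℕ) → State s → List Bool → State s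
runPasses A p zero q w = q
runPasses {s} A p (suc r) q w = runPasses A (suc p) r (runPass {s} (step A p) 0 q w) w

runAlg : {s : ℕ} → StreamAlg s → (R : ℕ) → List Bool → ℕ
runAlg A R w = out A (runPasses A 0 R (init A) w)

stream : {n : ℕ} → Vec Bool n → Vec Bool n → List Bool
stream x y = toList x ++ toList y

-- If two inputs x and y of length n produce the same transcript (the memory states at the
-- boundary between the two halves, in every pass), then the algorithm cannot tell x ++ y from
-- x ++ x, whose edit distance is 0; an accurate estimate therefore forces ED(x, y) ≤ n/48.
-- Hence x is determined by its transcript (2Rs bits) together with an edit script of cost
-- at most n/48 from a fixed representative of the transcript. A script of length ≤ 2n is cut
-- into ⌈n/2⌉ blocks of 4 operations; storing one flag per block and the at most n/48
-- non-trivial blocks takes ⌈n/2⌉ + n/4 bits. Counting gives n ≤ 2Rs + 3n/4 + 1.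

module Submission where

open import Defs
open import Data.Bool using (Bool; true; false; if_then_else_)
open import Data.Bool.Properties using () renaming (_≟_ to _≟B_)
import Data.Fin as Fin
open import Data.Fin using (Fin; combine; remQuot)
open import Data.Fin.Properties using (2↔Bool; injective⇒≤; remQuot-combine; combine-remQuot)
open import Data.List using (List; []; _∷_; length; _++_; replicate)
open import Data.Nat
open import Data.Nat.DivMod using (_/_; m/n*n≤m; /-monoˡ-≤; m*n/n≡m)
open import Data.Nat.Properties
open import Data.Nat.Tactic.RingSolver using (solve-∀)
open import Data.Product using (Σ; _×_; _,_; proj₁; proj₂; uncurry)
open import Data.Sum using (inj₁; inj₂)
open import Data.Vec as Vec using (Vec; []; _∷_; toList; concat; group)
  renaming (_++_ to _++ᵥ_)
open import Data.Vec.Properties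
  using (++-injectiveˡ; ++-injectiveʳ; toList-++; length-toList; toList-injective; ∷-injectiveˡ; ∷-injectiveʳ)
  renaming (≡-dec to Vec-≡-dec)
open import Data.Vec.Relation.Binary.Equality.Cast using (cast-is-id)
open import Data.Vec.Relation.Unary.All using (All; []; _∷_; all?)
open import Function using (_∘_; Inverse)
open import Function.Consequences.Propositional using (inverseʳ⇒injective; strictlyInverseʳ⇒inverseʳ)
open import Function.Definitions using (Injective; StrictlyInverseʳ)
open import Relation.Binary.PropositionalEquality
open import Relation.Nullary using (Dec; yes; no; does; ¬_; contradiction)
open import Relation.Unary using (Decidable)

strictlyInverseʳ⇒injective : ∀ {A B : Set} {f : A → B} (g : B → A) →
  StrictlyInverseʳ _≡_ f g → Injective _≡_ _≡_ f
strictlyInverseʳ⇒injective {f = f} g g∘f≡id =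
  inverseʳ⇒injective {f⁻¹ = g} f (strictlyInverseʳ⇒inverseʳ f g∘f≡id)

padTo : ∀ {A : Set} → A → (N : ℕ) → List A → Vec A N
padTo a zero    _       = []
padTo a (suc N) []      = a ∷ padTo a N []
padTo a (suc N) (x ∷ l) = x ∷ padTo a N l

toList-padTo : ∀ {A : Set} (a : A) N l → length l ≤ N →
  toList (padTo a N l) ≡ l ++ replicate (N ∸ length l) a
toList-padTo a zero    []      _         = refl
toList-padTo a (suc N) []      _         = cong (a ∷_) (toList-padTo a N [] z≤n)
toList-padTo a (suc N) (x ∷ l) (s≤s l≤N) = cong (x ∷_) (toList-padTo a N l l≤N)

module SparseBlocks {A : Set} (blank : A) (blank? : ∀ a → Dec (a ≡ blank)) where

  weight : List A → ℕ
  weight []      = 0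
  weight (a ∷ l) = if does (blank? a) then weight l else suc (weight l)

  weight-++ : ∀ l l′ → weight (l ++ l′) ≡ weight l + weight l′
  weight-++ []      l′ = refl
  weight-++ (a ∷ l) l′ with does (blank? a)
  ... | true  = weight-++ l l′
  ... | false = cong suc (weight-++ l l′)

  weight-replicate-blank : ∀ j → weight (replicate j blank) ≡ 0
  weight-replicate-blank zero    = refl
  weight-replicate-blank (suc j) with blank? blank
  ... | yes _   = weight-replicate-blank j
  ... | no  b≢b = contradiction refl b≢b

  Blank : ∀ {b} → Vec A b → Set
  Blank = All (_≡ blank)

  Blank⇒≡replicate : ∀ {b} {c : Vec A b} → Blank c → c ≡ Vec.replicate b blank
  Blank⇒≡replicate []           = refl
  Blank⇒≡replicate (refl ∷ all) = cong (blank ∷_) (Blank⇒≡replicate all)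

  ¬Blank⇒weight>0 : ∀ {b} (c : Vec A b) → ¬ Blank c → 0 < weight (toList c)
  ¬Blank⇒weight>0 []      ¬blank = contradiction [] ¬blank
  ¬Blank⇒weight>0 (a ∷ c) ¬blank with blank? a
  ... | yes a≡blank = ¬Blank⇒weight>0 c (¬blank ∘ (a≡blank ∷_))
  ... | no  _       = z<s

  blankFlags : ∀ {b m} → Vec (Vec A b) m → Vec Bool m
  blankFlags = Vec.map (does ∘ all? blank?)

  nonblank : ∀ {b m} → Vec (Vec A b) m → List (Vec A b)
  nonblank []       = []
  nonblank (c ∷ cs) = if does (all? blank? c) then nonblank cs else c ∷ nonblank cs

  length-nonblank≤weight : ∀ {b m} (cs : Vec (Vec A b) m) →
    length (nonblank cs) ≤ weight (toList (concat cs))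
  length-nonblank≤weight []       = z≤n
  length-nonblank≤weight (c ∷ cs)
    rewrite toList-++ c (concat cs) | weight-++ (toList c) (toList (concat cs))
    with all? blank? c
  ... | yes _      = ≤-trans (length-nonblank≤weight cs) (m≤n+m _ _)
  ... | no  ¬blank = +-mono-≤ (¬Blank⇒weight>0 c ¬blank) (length-nonblank≤weight cs)

  -- The third clause is reached only on pairs that `compress` does not produce.
  expand : ∀ {b m} → Vec Bool m → List (Vec A b) → Vec (Vec A b) m
  expand         []           _        = []
  expand {b}     (true  ∷ fs) ps       = Vec.replicate b blank ∷ expand fs ps
  expand {b}     (false ∷ fs) []       = Vec.replicate b blank ∷ expand fs []
  expand         (false ∷ fs) (p ∷ ps) = p ∷ expand fs ps

  expand-nonblank : ∀ {b m} (cs : Vec (Vec A b) m) junk →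
    expand (blankFlags cs) (nonblank cs ++ junk) ≡ cs
  expand-nonblank []       _    = refl
  expand-nonblank (c ∷ cs) junk with all? blank? c
  ... | yes blank-c = cong₂ _∷_ (sym (Blank⇒≡replicate blank-c)) (expand-nonblank cs junk)
  ... | no  _       = cong (c ∷_) (expand-nonblank cs junk)

  compress : ∀ b m r → List A → Vec Bool m × Vec (Vec A b) r
  compress b m r l = blankFlags cs , padTo (Vec.replicate b blank) r (nonblank cs)
    where cs = proj₁ (group m b (padTo blank (m * b) l))

  decompress : ∀ {b m r} → Vec Bool m × Vec (Vec A b) r → List A
  decompress (fs , ps) = toList (concat (expand fs (toList ps)))

  decompress-compress : ∀ b m r l → length l ≤ m * b → weight l ≤ r →
    decompress (compress b m r l) ≡ l ++ replicate (m * b ∸ length l) blank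
  decompress-compress b m r l l≤mb weight≤r = begin
      toList (concat (expand (blankFlags cs) (toList (padTo blankBlock r (nonblank cs)))))
    ≡⟨ cong (toList ∘ concat ∘ expand (blankFlags cs))
            (toList-padTo blankBlock r (nonblank cs) few-nonblank) ⟩
      toList (concat (expand (blankFlags cs) (nonblank cs ++ _)))
    ≡⟨ cong (toList ∘ concat) (expand-nonblank cs _) ⟩
      toList (concat cs)
    ≡⟨ cong toList padded≡concat ⟨
      toList padded
    ≡⟨ toList-padTo blank (m * b) l l≤mb ⟩
      l ++ replicate (m * b ∸ length l) blank ∎
    where
    open ≡-Reasoning
    blankBlock = Vec.replicate b blank
    padded     = padTo blank (m * b) l
    cs         = proj₁ (group m b padded)
    padded≡concat : padded ≡ concat cs
    padded≡concat = proj₂ (group m b padded)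
    weight-blocks : weight (toList (concat cs)) ≡ weight l
    weight-blocks = begin
      weight (toList (concat cs))                  ≡⟨ cong (weight ∘ toList) padded≡concat ⟨
      weight (toList padded)                       ≡⟨ cong weight (toList-padTo blank (m * b) l l≤mb) ⟩
      weight (l ++ replicate (m * b ∸ length l) blank)
        ≡⟨ weight-++ l _ ⟩
      weight l + weight (replicate (m * b ∸ length l) blank)
        ≡⟨ cong (weight l +_) (weight-replicate-blank (m * b ∸ length l)) ⟩
      weight l + 0                                 ≡⟨ +-identityʳ _ ⟩
      weight l                                     ∎
    few-nonblank : length (nonblank cs) ≤ r
    few-nonblank = ≤-trans (length-nonblank≤weight cs) (≤-trans (≤-reflexive weight-blocks) weight≤r)

encodeVec : ∀ {A B : Set} {k r} → (A → Vec B k) → Vec A r → Vec B (r * k)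
encodeVec e = concat ∘ Vec.map e

encodeVec-injective : ∀ {A B : Set} {k r} {e : A → Vec B k} →
  Injective _≡_ _≡_ e → Injective _≡_ _≡_ (encodeVec {r = r} e)
encodeVec-injective         e-inj {[]}    {[]}      _  = refl
encodeVec-injective {e = e} e-inj {a ∷ v} {a′ ∷ v′} eq =
  cong₂ _∷_ (e-inj (++-injectiveˡ (e a) (e a′) eq))
            (encodeVec-injective e-inj (++-injectiveʳ (e a) (e a′) eq))

encodePair : ∀ {B : Set} {m n} → Vec B m × Vec B n → Vec B (m + n)
encodePair = uncurry _++ᵥ_

encodePair-injective : ∀ {B : Set} {m n} → Injective _≡_ _≡_ (encodePair {B} {m} {n})
encodePair-injective {x = u , v} {u′ , v′} eq =
  cong₂ _,_ (++-injectiveˡ u u′ eq) (++-injectiveʳ u u′ eq)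

toFin : ∀ {n} → Vec Bool n → Fin (2 ^ n)
toFin []      = Fin.zero
toFin (b ∷ v) = combine (Inverse.from 2↔Bool b) (toFin v)

fromFin : ∀ n → Fin (2 ^ n) → Vec Bool n
fromFin zero    _ = []
fromFin (suc n) i = Inverse.to 2↔Bool (proj₁ bj) ∷ fromFin n (proj₂ bj)
  where bj = remQuot (2 ^ n) i

fromFin-toFin : ∀ {n} (v : Vec Bool n) → fromFin n (toFin v) ≡ v
fromFin-toFin []      = refl
fromFin-toFin {suc n} (b ∷ v) = begin
    fromFin (suc n) (combine (Inverse.from 2↔Bool b) (toFin v))
  ≡⟨ cong (λ bj → Inverse.to 2↔Bool (proj₁ bj) ∷ fromFin n (proj₂ bj))
          (remQuot-combine (Inverse.from 2↔Bool b) (toFin v)) ⟩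
    Inverse.to 2↔Bool (Inverse.from 2↔Bool b) ∷ fromFin n (toFin v)
  ≡⟨ cong₂ _∷_ (Inverse.strictlyInverseˡ 2↔Bool b) (fromFin-toFin v) ⟩
    b ∷ v ∎
  where open ≡-Reasoning

toFin-fromFin : ∀ n (i : Fin (2 ^ n)) → toFin (fromFin n i) ≡ i
toFin-fromFin zero    Fin.zero = refl
toFin-fromFin (suc n) i = begin
    combine (Inverse.from 2↔Bool (Inverse.to 2↔Bool (proj₁ bj))) (toFin (fromFin n (proj₂ bj)))
  ≡⟨ cong₂ combine (Inverse.strictlyInverseʳ 2↔Bool (proj₁ bj)) (toFin-fromFin n (proj₂ bj)) ⟩
    uncurry combine bj
  ≡⟨ combine-remQuot (2 ^ n) i ⟩
    i ∎
  where
  open ≡-Reasoning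
  bj = remQuot (2 ^ n) i

injective⇒length≤ : ∀ {m n} {f : Vec Bool m → Vec Bool n} → Injective _≡_ _≡_ f → m ≤ n
injective⇒length≤ {m} {n} {f} f-inj =
  ≮⇒≥ λ n<m → <⇒≱ (^-monoʳ-< 2 (n<1+n 1) n<m) (injective⇒≤ (fromFin-inj ∘ f-inj ∘ toFin-inj))
  where
  toFin-inj : Injective _≡_ _≡_ (toFin {n})
  toFin-inj = strictlyInverseʳ⇒injective (fromFin n) fromFin-toFin
  fromFin-inj : Injective _≡_ _≡_ (fromFin m)
  fromFin-inj = strictlyInverseʳ⇒injective toFin (toFin-fromFin m)

search : ∀ {n} {P : Vec Bool n → Set} → Decidable P → Vec Bool n
search {zero}  P? = []
search {suc n} P? with P? (true ∷ search (λ v → P? (true ∷ v)))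
... | yes _ = true  ∷ search (λ v → P? (true ∷ v))
... | no  _ = false ∷ search (λ v → P? (false ∷ v))

search-sound : ∀ {n} {P : Vec Bool n → Set} (P? : Decidable P) {x} → P x → P (search P?)
search-sound {zero}  P? {[]}    px = px
search-sound {suc n} P? {b ∷ x} px with P? (true ∷ search (λ v → P? (true ∷ v)))
... | yes p = p
... | no ¬p with b
...   | true  = contradiction (search-sound (λ v → P? (true ∷ v)) px) ¬p
...   | false = search-sound (λ v → P? (false ∷ v)) px

data EditOp : Set where
  keep del : EditOp
  sub ins  : Bool → EditOp

-- Operations that consume a character are skipped once the input is exhausted.
apply : List EditOp → List Bool → List Bool
apply []            xs       = xs
apply (keep  ∷ o)   []       = apply o []
apply (keep  ∷ o)   (x ∷ xs) = x ∷ apply o xs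
apply (del   ∷ o)   []       = apply o []
apply (del   ∷ o)   (x ∷ xs) = apply o xs
apply (sub b ∷ o)   []       = apply o []
apply (sub b ∷ o)   (x ∷ xs) = b ∷ apply o xs
apply (ins b ∷ o)   xs       = b ∷ apply o xs

apply-++-keeps : ∀ o j xs → apply (o ++ replicate j keep) xs ≡ apply o xs
apply-++-keeps []          zero    xs       = refl
apply-++-keeps []          (suc j) []       = apply-++-keeps [] j []
apply-++-keeps []          (suc j) (x ∷ xs) = cong (x ∷_) (apply-++-keeps [] j xs)
apply-++-keeps (keep  ∷ o) j       []       = apply-++-keeps o j []
apply-++-keeps (keep  ∷ o) j       (x ∷ xs) = cong (x ∷_) (apply-++-keeps o j xs)
apply-++-keeps (del   ∷ o) j       []       = apply-++-keeps o j []
apply-++-keeps (del   ∷ o) j       (x ∷ xs) = apply-++-keeps o j xs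
apply-++-keeps (sub b ∷ o) j       []       = apply-++-keeps o j []
apply-++-keeps (sub b ∷ o) j       (x ∷ xs) = cong (b ∷_) (apply-++-keeps o j xs)
apply-++-keeps (ins b ∷ o) j       xs       = cong (b ∷_) (apply-++-keeps o j xs)

keep? : ∀ o → Dec (o ≡ keep)
keep? keep    = yes refl
keep? del     = no λ ()
keep? (sub _) = no λ ()
keep? (ins _) = no λ ()

open SparseBlocks keep keep? using (compress; decompress; decompress-compress)
  renaming (weight to cost)

encodeOp : EditOp → Vec Bool 3
encodeOp keep    = false ∷ false ∷ false ∷ []
encodeOp del     = false ∷ false ∷ true  ∷ []
encodeOp (sub b) = false ∷ true  ∷ b     ∷ []
encodeOp (ins b) = true  ∷ b     ∷ false ∷ []

decodeOp : Vec Bool 3 → EditOp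
decodeOp (false ∷ false ∷ false ∷ []) = keep
decodeOp (false ∷ false ∷ true  ∷ []) = del
decodeOp (false ∷ true  ∷ b     ∷ []) = sub b
decodeOp (true  ∷ b     ∷ _     ∷ []) = ins b

encodeOp-injective : Injective _≡_ _≡_ encodeOp
encodeOp-injective = strictlyInverseʳ⇒injective decodeOp λ where
  keep    → refl
  del     → refl
  (sub b) → refl
  (ins b) → refl

record EditScript (xs ys : List Bool) (c : ℕ) : Set where
  field
    ops        : List EditOp
    apply-ops  : apply ops xs ≡ ys
    cost-ops   : cost ops ≤ c
    length-ops : length ops ≤ length xs + length ys

module _ {xs ys : List Bool} {c : ℕ} (e : EditScript xs ys c) where
  open EditScript e

  insert : ∀ y → EditScript xs (y ∷ ys) (suc c)
  insert y = record
    { ops        = ins y ∷ ops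
    ; apply-ops  = cong (y ∷_) apply-ops
    ; cost-ops   = s≤s cost-ops
    ; length-ops = ≤-trans (s≤s length-ops) (≤-reflexive (sym (+-suc (length xs) (length ys))))
    }

  delete : ∀ x → EditScript (x ∷ xs) ys (suc c)
  delete x = record
    { ops        = del ∷ ops
    ; apply-ops  = apply-ops
    ; cost-ops   = s≤s cost-ops
    ; length-ops = s≤s length-ops
    }

  private
    one-more : suc (length ops) ≤ suc (length xs) + suc (length ys)
    one-more = s≤s (≤-trans length-ops (+-monoʳ-≤ (length xs) (n≤1+n _)))

  substitute : ∀ x y → EditScript (x ∷ xs) (y ∷ ys) (c + (if does (x ≟B y) then 0 else 1))
  substitute x y with x ≟B y
  ... | yes refl = record
    { ops        = keep ∷ ops
    ; apply-ops  = cong (x ∷_) apply-ops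
    ; cost-ops   = ≤-trans cost-ops (m≤m+n c 0)
    ; length-ops = one-more
    }
  ... | no _ = record
    { ops        = sub y ∷ ops
    ; apply-ops  = cong (y ∷_) apply-ops
    ; cost-ops   = ≤-trans (s≤s cost-ops) (≤-reflexive (+-comm 1 c))
    ; length-ops = one-more
    }

cheapest : ∀ {xs ys a b} → EditScript xs ys a → EditScript xs ys b → EditScript xs ys (a ⊓ b)
cheapest {xs} {ys} {a} {b} e e′ with ⊓-sel a b
... | inj₁ a⊓b≡a = subst (EditScript xs ys) (sym a⊓b≡a) e
... | inj₂ a⊓b≡b = subst (EditScript xs ys) (sym a⊓b≡b) e′

empty : EditScript [] [] 0
empty = record { ops = [] ; apply-ops = refl ; cost-ops = z≤n ; length-ops = z≤n }

editScript : ∀ xs ys → EditScript xs ys (ED xs ys)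
editScript []            []       = empty
editScript []            (y ∷ ys) = insert (editScript [] ys) y
editScript (x ∷ [])      []       = delete empty x
editScript (x ∷ x′ ∷ xs) []       = delete (editScript (x′ ∷ xs) []) x
editScript (x ∷ xs)      (y ∷ ys) =
  cheapest (substitute (editScript xs ys) x y)
           (cheapest (delete (editScript xs (y ∷ ys)) x) (insert (editScript (x ∷ xs) ys) y))

ED-refl : ∀ xs → ED xs xs ≡ 0
ED-refl []           = refl
ED-refl (false ∷ xs) rewrite ED-refl xs = refl
ED-refl (true  ∷ xs) rewrite ED-refl xs = refl

fibre-bound : ∀ {n t} (T : Vec Bool n → Vec Bool t) (b m r : ℕ) → n + n ≤ m * b →
  (∀ x y → T x ≡ T y → ED (toList x) (toList y) ≤ r) →
  n ≤ t + (m + r * (b * 3))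
fibre-bound {n} {t} T b m r 2n≤mb fibre-ED≤r = injective⇒length≤ encode-injective
  where
  representative : Vec Bool t → Vec Bool n
  representative τ = search (λ v → Vec-≡-dec _≟B_ (T v) τ)

  T-representative : ∀ x → T (representative (T x)) ≡ T x
  T-representative x = search-sound (λ v → Vec-≡-dec _≟B_ (T v) (T x)) refl

  source : Vec Bool n → List Bool
  source x = toList (representative (T x))

  script : ∀ x → EditScript (source x) (toList x) (ED (source x) (toList x))
  script x = editScript (source x) (toList x)

  packed : Vec Bool n → Vec Bool m × Vec (Vec EditOp b) r
  packed x = compress b m r (EditScript.ops (script x))

  reconstruct : ∀ x → apply (decompress (packed x)) (source x) ≡ toList x
  reconstruct x = begin
      apply (decompress (packed x)) (source x)
    ≡⟨ cong (λ o → apply o (source x)) (decompress-compress b m r ops short cheap) ⟩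
      apply (ops ++ replicate (m * b ∸ length ops) keep) (source x)
    ≡⟨ apply-++-keeps ops _ (source x) ⟩
      apply ops (source x)
    ≡⟨ apply-ops ⟩
      toList x ∎
    where
    open ≡-Reasoning
    open EditScript (script x)
    short : length ops ≤ m * b
    short = ≤-trans length-ops
      (subst (_≤ m * b) (sym (cong₂ _+_ (length-toList (representative (T x))) (length-toList x))) 2n≤mb)
    cheap : cost ops ≤ r
    cheap = ≤-trans cost-ops (fibre-ED≤r _ x (T-representative x))

  encodePacked : Vec Bool m × Vec (Vec EditOp b) r → Vec Bool (m + r * (b * 3))
  encodePacked (flags , blocks) = flags ++ᵥ encodeVec (encodeVec encodeOp) blocks

  encodePacked-injective : Injective _≡_ _≡_ encodePacked
  encodePacked-injective {flags , _} {flags′ , _} eq = cong₂ _,_ (++-injectiveˡ flags flags′ eq)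
    (encodeVec-injective (encodeVec-injective encodeOp-injective) (++-injectiveʳ flags flags′ eq))

  encode : Vec Bool n → Vec Bool (t + (m + r * (b * 3)))
  encode x = T x ++ᵥ encodePacked (packed x)

  encode-injective : Injective _≡_ _≡_ encode
  encode-injective {x} {y} eq = trans (sym (cast-is-id refl x)) (toList-injective refl x y (begin
      toList x                                 ≡⟨ reconstruct x ⟨
      apply (decompress (packed x)) (source x)
        ≡⟨ cong₂ (λ p τ → apply (decompress p) (toList (representative τ))) packed≡ T≡ ⟩
      apply (decompress (packed y)) (source y) ≡⟨ reconstruct y ⟩
      toList y                                 ∎))
    where
    open ≡-Reasoning
    T≡ : T x ≡ T y
    T≡ = ++-injectiveˡ (T x) (T y) eq
    packed≡ : packed x ≡ packed y
    packed≡ = encodePacked-injective (++-injectiveʳ (T x) (T y) eq)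

runPass-++ : ∀ {s} (f : ℕ → State s → Bool → State s) i q xs ys →
  runPass f i q (xs ++ ys) ≡ runPass f (i + length xs) (runPass f i q xs) ys
runPass-++ f i q []       ys = cong (λ j → runPass f j q ys) (sym (+-identityʳ i))
runPass-++ f i q (b ∷ xs) ys = trans (runPass-++ f (suc i) (f i q b) xs ys)
  (cong (λ j → runPass f j (runPass f (suc i) (f i q b) xs) ys) (sym (+-suc i (length xs))))

runPass-cut : ∀ {s} (f : ℕ → State s → Bool → State s) q x y →
  length x ≡ length y → runPass f 0 q x ≡ runPass f 0 q y →
  runPass f 0 q (x ++ y) ≡ runPass f 0 q (y ++ y)
runPass-cut f q x y |x|≡|y| mid≡ = begin
    runPass f 0 q (x ++ y)                   ≡⟨ runPass-++ f 0 q x y ⟩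
    runPass f (length x) (runPass f 0 q x) y ≡⟨ cong₂ (λ i q′ → runPass f i q′ y) |x|≡|y| mid≡ ⟩
    runPass f (length y) (runPass f 0 q y) y ≡⟨ runPass-++ f 0 q y y ⟨
    runPass f 0 q (y ++ y)                   ∎
  where open ≡-Reasoning

Transcript : ℕ → ℕ → Set
Transcript s r = Vec (State s × State s) r

transcript : ∀ {s} → StreamAlg s → (p r : ℕ) → State s → List Bool → Transcript s r
transcript A p zero    q x = []
transcript A p (suc r) q x = (runPass (step A p) 0 q x , q′) ∷ transcript A (suc p) r q′ x
  where q′ = runPass (step A p) 0 q (x ++ x)

runPasses-cut : ∀ {s} (A : StreamAlg s) p r q x y → length x ≡ length y →
  transcript A p r q x ≡ transcript A p r q y →
  runPasses A p r q (x ++ y) ≡ runPasses A p r q (x ++ x)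
runPasses-cut A p zero    q x y _       _  = refl
runPasses-cut A p (suc r) q x y |x|≡|y| τ≡ = begin
    runPasses A (suc p) r (runPass f 0 q (x ++ y)) (x ++ y)
  ≡⟨ cong (λ q′ → runPasses A (suc p) r q′ (x ++ y))
          (trans (runPass-cut f q x y |x|≡|y| (cong proj₁ heads≡)) (sym end≡)) ⟩
    runPasses A (suc p) r end (x ++ y)
  ≡⟨ runPasses-cut A (suc p) r end x y |x|≡|y|
       (trans (∷-injectiveʳ τ≡) (cong (λ q′ → transcript A (suc p) r q′ y) (sym end≡))) ⟩
    runPasses A (suc p) r end (x ++ x) ∎
  where
  open ≡-Reasoning
  f   = step A p
  end = runPass f 0 q (x ++ x)
  heads≡ : (runPass f 0 q x , end) ≡ (runPass f 0 q y , runPass f 0 q (y ++ y))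
  heads≡ = ∷-injectiveˡ τ≡
  end≡ : end ≡ runPass f 0 q (y ++ y)
  end≡ = cong proj₂ heads≡

transcriptBits : ∀ {s} → StreamAlg s → (R : ℕ) → List Bool → Vec Bool (R * (s + s))
transcriptBits A R x = encodeVec encodePair (transcript A 0 R (init A) x)

estimate-bound : ∀ k o e n → 2 * k * o ≤ n → 2 * k * ∣ o - e ∣ ≤ n → k * e ≤ n
estimate-bound k o e n ko≤n k∣o-e∣≤n = *-cancelˡ-≤ 2 (begin
  2 * (k * e)                           ≡⟨ *-assoc 2 k e ⟨
  2 * k * e                             ≤⟨ *-monoʳ-≤ (2 * k) (m≤n+∣n-m∣ e o) ⟩
  2 * k * (o + ∣ o - e ∣)               ≡⟨ *-distribˡ-+ (2 * k) o _ ⟩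
  2 * k * o + 2 * k * ∣ o - e ∣         ≤⟨ +-mono-≤ ko≤n k∣o-e∣≤n ⟩
  n + n                                 ≡⟨ cong (n +_) (+-identityʳ n) ⟨
  2 * n                                 ∎)
  where open ≤-Reasoning

transcript-fibre-ED : ∀ {s n} (A : StreamAlg s) R k →
  (∀ (x y : Vec Bool n) → 2 * k * ∣ runAlg A R (stream x y) - ED (toList x) (toList y) ∣ ≤ n) →
  ∀ x y → transcriptBits A R (toList x) ≡ transcriptBits A R (toList y) →
  k * ED (toList x) (toList y) ≤ n
transcript-fibre-ED A R k accurate x y bits≡ = estimate-bound k o _ _ o-small
  (subst (λ o′ → 2 * k * ∣ o′ - ED (toList x) (toList y) ∣ ≤ _) same-output (accurate x y))
  where
  o = runAlg A R (stream x x)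
  same-output : runAlg A R (stream x y) ≡ o
  same-output = cong (out A) (runPasses-cut A 0 R (init A) (toList x) (toList y)
    (trans (length-toList x) (sym (length-toList y)))
    (encodeVec-injective encodePair-injective bits≡))
  o-small : 2 * k * o ≤ _
  o-small = subst (λ e → 2 * k * e ≤ _)
    (trans (cong (λ e → ∣ o - e ∣) (ED-refl (toList x))) (∣-∣-identityʳ o)) (accurate x x)

m*n≤o⇒m≤o/n : ∀ m n o .{{_ : NonZero n}} → m * n ≤ o → m ≤ o / n
m*n≤o⇒m≤o/n m n o mn≤o = subst (_≤ o / n) (m*n/n≡m m n) (/-monoˡ-≤ n mn≤o)

n+n≤⌈n/2⌉*4 : ∀ n → n + n ≤ ⌈ n /2⌉ * 4
n+n≤⌈n/2⌉*4 n = ≤-trans (+-mono-≤ n≤h+h n≤h+h) (≤-reflexive (four-times ⌈ n /2⌉))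
  where
  n≤h+h : n ≤ ⌈ n /2⌉ + ⌈ n /2⌉
  n≤h+h = subst (_≤ ⌈ n /2⌉ + ⌈ n /2⌉) (⌊n/2⌋+⌈n/2⌉≡n n) (+-monoˡ-≤ ⌈ n /2⌉ (⌊n/2⌋≤⌈n/2⌉ n))
  four-times : ∀ h → (h + h) + (h + h) ≡ h * 4
  four-times = solve-∀

⌈n/2⌉+⌈n/2⌉≤1+n : ∀ n → ⌈ n /2⌉ + ⌈ n /2⌉ ≤ suc n
⌈n/2⌉+⌈n/2⌉≤1+n n = subst (⌈ n /2⌉ + ⌈ n /2⌉ ≤_) (⌊n/2⌋+⌈n/2⌉≡n (suc n))
  (+-monoʳ-≤ ⌈ n /2⌉ (⌈n/2⌉-mono (n≤1+n n)))

counting-arith : ∀ n R s h q → n ≤ R * (s + s) + (h + q * 12) →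
  h + h ≤ suc n → q * 48 ≤ n → n ≤ 8 * (R * s) + 2
counting-arith n R s h q n≤bits h+h≤1+n q*48≤n = +-cancelʳ-≤ (3 * n) n (8 * (R * s) + 2) (begin
  n + 3 * n                                   ≡⟨ four-n n ⟩
  4 * n                                       ≤⟨ *-monoʳ-≤ 4 n≤bits ⟩
  4 * (R * (s + s) + (h + q * 12))            ≡⟨ expand R s h q ⟩
  8 * (R * s) + 2 * (h + h) + q * 48          ≤⟨ +-mono-≤ (+-monoʳ-≤ (8 * (R * s)) (*-monoʳ-≤ 2 h+h≤1+n)) q*48≤n ⟩
  8 * (R * s) + 2 * suc n + n                 ≡⟨ regroup (R * s) n ⟩
  8 * (R * s) + 2 + 3 * n                     ∎)
  where
  open ≤-Reasoning
  four-n : ∀ n → n + 3 * n ≡ 4 * n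
  four-n = solve-∀
  expand : ∀ R s h q → 4 * (R * (s + s) + (h + q * 12)) ≡ 8 * (R * s) + 2 * (h + h) + q * 48
  expand = solve-∀
  regroup : ∀ P n → 8 * P + 2 * suc n + n ≡ 8 * P + 2 + 3 * n
  regroup = solve-∀

absorb-constant : ∀ n P → 3 ≤ n → n ≤ 8 * P + 2 → n ≤ 10 * P
absorb-constant n zero    3≤n n≤2 = contradiction (≤-trans 3≤n n≤2) (<⇒≱ ≤-refl)
absorb-constant n (suc P) _   n≤  = ≤-trans n≤ (≤-trans (m≤m+n _ (2 * P)) (≤-reflexive (slack P)))
  where
  slack : ∀ P → 8 * suc P + 2 + 2 * P ≡ 10 * suc P
  slack = solve-∀

theoremA1 : Σ ℕ λ k → Σ ℕ λ d → Σ ℕ λ n₀ → 1 ≤ k ×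
    ((n : ℕ) → n₀ ≤ n → (R : ℕ) → 1 ≤ R → (s : ℕ) → (A : StreamAlg s) →
    ((x y : Vec Bool n) → k * ∣ runAlg A R (stream x y) - ED (toList x) (toList y) ∣ ≤ n) →
    n ≤ d * (R * s))
theoremA1 = 96 , 10 , 3 , s≤s z≤n , λ n 3≤n R _ s A accurate →
  let bits-bound : n ≤ R * (s + s) + (⌈ n /2⌉ + n / 48 * 12)
      bits-bound = fibre-bound (transcriptBits A R ∘ toList) 4 ⌈ n /2⌉ (n / 48) (n+n≤⌈n/2⌉*4 n)
        λ x y bits≡ → m*n≤o⇒m≤o/n _ 48 n
          (subst (_≤ n) (*-comm 48 (ED (toList x) (toList y))) (transcript-fibre-ED A R 48 accurate x y bits≡))
  in absorb-constant n (R * s) 3≤n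
       (counting-arith n R s ⌈ n /2⌉ (n / 48) bits-bound (⌈n/2⌉+⌈n/2⌉≤1+n n) (m/n*n≤m n 48))
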